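{- Let $\mathcal{C}$ be a minimum-transversal-covered clutter on a finite set $E$ satisfying the integral blocking condition. Then $\tilde{\mathcal{C}}$ is minimum-transversal-covered and satisfies the integral blocking condition, and $\mathrm{minb}(\mathcal{C})\subseteq\mathrm{minb}(\tilde{\mathcal{C}})$.
   Context: A clutter on $E$ is a family of subsets none containing another (members: hyperedges). A transversal is an inclusion-minimal subset meeting every hyperedge; $\mathrm{bn}(\mathcal{C})$ the minimum transversal size; $\mathrm{minb}(\mathcal{C})$ the set of minimum-size transversals; minimum-transversal-covered means $\bigcup\mathrm{minb}(\mathcal{C})=E$. A fractional packing is $y:\mathcal{C}\to\mathbb{R}_{\ge0}$ with $\sum_{H\ni a}y(H)\le1$ for all $a$; $\mathrm{fpn}(\mathcal{C})$ is the maximum of $\sum_Hy(H)$. Integral blocking condition: $\mathrm{fpn}(\mathcal{C})=\mathrm{bn}(\mathcal{C})$. $\tilde{\mathcal{C}}=\{H\in\mathcal{C}:|H\cap B|=1\ \forall B\in\mathrm{minb}(\mathcal{C})\}$.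
   Formalization: Fractional packings y take nonnegative rational values instead of values in $\mathbb{R}_{\ge0}$, so fpn and the integral blocking condition, for $\mathcal{C}$ and $\tilde{\mathcal{C}}$, refer to such packings. -}

module Defs where

open import Data.Nat using (ℕ)
import Data.Nat
open import Data.Fin using (Fin)
open import Data.Fin.Subset using (Subset; _∈_; _⊆_; _∩_; ∣_∣)
open import Data.Bool using (if_then_else_)
open import Data.Vec using (lookup)
open import Data.List using (List; foldr; map)
open import Data.List.Relation.Unary.Unique.Propositional using (Unique)
import Data.List.Membership.Propositional as LM
open import Data.Rational using (ℚ; _+_; _≤_; 0ℚ; 1ℚ)
import Data.Rational as Q
import Data.Integer as ℤ
open import Data.Product using (Σ; _×_)
open import Relation.Binary.PropositionalEquality using (_≡_)

Family : ℕ → Set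
Family n = List (Subset n)

record Clutter {n : ℕ} (C : Family n) : Set where
  field
    distinct   : Unique C
    antichain  : ∀ {H H′} → H LM.∈ C → H′ LM.∈ C → H ⊆ H′ → H ≡ H′

Cover : ∀ {n} → Family n → Subset n → Set
Cover C B = ∀ {H} → H LM.∈ C → Σ _ λ a → a ∈ H × a ∈ B

Transversal : ∀ {n} → Family n → Subset n → Set
Transversal C B = Cover C B × (∀ B′ → B′ ⊆ B → Cover C B′ → B′ ≡ B)

MinTransversal : ∀ {n} → Family n → Subset n → Set
MinTransversal C B = Transversal C B × (∀ B′ → Transversal C B′ → ∣ B ∣ Data.Nat.≤ ∣ B′ ∣)

IsBn : ∀ {n} → Family n → ℕ → Set
IsBn C k = (Σ _ λ B → MinTransversal C B × ∣ B ∣ ≡ k)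

MinTransversalCovered : ∀ {n} → Family n → Set
MinTransversalCovered {n} C = ∀ (a : Fin n) → Σ _ λ B → MinTransversal C B × a ∈ B

sumℚ : List ℚ → ℚ
sumℚ = foldr _+_ 0ℚ

value : ∀ {n} → Family n → (Subset n → ℚ) → ℚ
value C y = sumℚ (map y C)

load : ∀ {n} → Family n → (Subset n → ℚ) → Fin n → ℚ
load C y a = sumℚ (map (λ H → if lookup H a then y H else 0ℚ) C)

FractionalPacking : ∀ {n} → Family n → (Subset n → ℚ) → Set
FractionalPacking {n} C y =
  (∀ {H} → H LM.∈ C → 0ℚ ≤ y H) × (∀ (a : Fin n) → load C y a ≤ 1ℚ)

IsFpn : ∀ {n} → Family n → ℚ → Set
IsFpn C q =
  (Σ _ λ y → FractionalPacking C y × value C y ≡ q) ×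
  (∀ y → FractionalPacking C y → value C y ≤ q)

IntegralBlocking : ∀ {n} → Family n → Set
IntegralBlocking C = Σ ℕ λ k → IsBn C k × IsFpn C ((ℤ.+ k) Q./ 1)

-- Ct is (a list enumeration of) C̃ = {H ∈ C : |H ∩ B| = 1 for all B ∈ minb(C)}
IsTilde : ∀ {n} → Family n → Family n → Set
IsTilde C Ct =
  Unique Ct ×
  (∀ H → H LM.∈ Ct → H LM.∈ C × (∀ B → MinTransversal C B → ∣ H ∩ B ∣ ≡ 1)) ×
  (∀ H → H LM.∈ C → (∀ B → MinTransversal C B → ∣ H ∩ B ∣ ≡ 1) → H LM.∈ Ct)

{-# OPTIONS --safe #-}
module Submission where

-- An optimal fractional packing y of C certifies, for every cover S,
--   value y ≤ Σ_H y(H)·|H ∩ S| = Σ_{a ∈ S} load(a) ≤ |S|.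
-- For a minimum transversal S both inequalities are equalities, so every
-- hyperedge with y(H) > 0 meets every minimum transversal exactly once, i.e.
-- y is supported on C̃. Hence y is a packing of C̃ of value bn(C), and weak
-- duality for C̃ bounds every cover of C̃ below by bn(C). As C̃ ⊆ C, each
-- minimum transversal of C covers C̃ and is thus a minimum transversal of C̃.

open import Defs
open import Algebra.Bundles using (CommutativeMonoid)
open import Data.Bool using (true; false; if_then_else_)
import Data.Bool as Bool
open import Data.Fin using (Fin; zero; suc)
open import Data.Fin.Subset using (Subset; _∈_; _⊆_; _∩_; ∣_∣)
open import Data.Fin.Subset.Properties
  using (_∈?_; ⊆-antisym; p⊆q⇒∣p∣≤∣q∣; p⊂q⇒∣p∣<∣q∣; x∈⁅y⁆⇒x≡y; ∣⁅x⁆∣≡1; x∈p∩q⁺)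
open import Data.Integer as ℤ using (+≤+)
import Data.Integer.Properties as ℤ
open import Data.List using (List; []; _∷_; map; filter)
open import Data.List.Membership.Propositional using () renaming (_∈_ to _∈ₗ_; _∉_ to _∉ₗ_)
import Data.List.Membership.DecPropositional as DecMembership
open import Data.List.Membership.Propositional.Properties using (∈-filter⁺; ∈-filter⁻)
open import Data.List.Membership.Propositional.Properties.WithK using (unique∧set⇒bag)
open import Data.List.Relation.Binary.BagAndSetEquality using (∼bag⇒↭)
open import Data.List.Relation.Binary.Permutation.Propositional using (_↭_; ↭⇒↭ₛ)
open import Data.List.Relation.Binary.Permutation.Propositional.Properties using (map⁺)
open import Data.List.Relation.Unary.Any using (here; there)
open import Data.List.Relation.Unary.Unique.Propositional using (Unique)
open import Data.List.Relation.Unary.Unique.Propositional.Properties using (filter⁺)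
open import Data.Nat using (ℕ; suc) renaming (_≤_ to _≤ℕ_)
import Data.Nat.Properties as ℕ
open import Data.Nat.Coprimality using (1-coprimeTo)
import Data.Nat.Coprimality as Coprime
open import Data.Product using (_×_; _,_; proj₁; proj₂)
open import Data.Rational
  using (ℚ; mkℚ; _/_; _+_; _*_; _≤_; _<_; 0ℚ; 1ℚ; *≤*; Positive; positive; nonNegative)
open import Data.Rational.Properties
open import Data.Vec using ([]; _∷_; lookup)
open import Data.Vec.Properties using (≡-dec)
open import Function using (_∘_; mk⇔)
open import Relation.Binary.Definitions using (DecidableEquality)
open import Relation.Binary.PropositionalEquality as ≡
  using (_≡_; refl; sym; trans; cong; cong₂; subst; subst₂)
open import Relation.Nullary using (¬_; yes; no)
open import Relation.Nullary.Decidable using (decidable-stable)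
open import Relation.Unary using (Decidable)
open import Data.List.Relation.Binary.Permutation.Setoid.Properties (≡.setoid ℚ)
  using (foldr-commMonoid)
open import Algebra.Properties.CommutativeSemigroup
  (CommutativeMonoid.commutativeSemigroup +-0-commutativeMonoid) using (interchange)

ι : ℕ → ℚ
ι k = ℤ.+ k / 1

ι≡mkℚ : ∀ k → ι k ≡ mkℚ (ℤ.+ k) 0 (Coprime.sym (1-coprimeTo k))
ι≡mkℚ k = normalize-coprime (Coprime.sym (1-coprimeTo k))

ι-suc : ∀ k → ι (suc k) ≡ 1ℚ + ι k
ι-suc k rewrite ι≡mkℚ k | ℤ.*-identityʳ (ℤ.+ k) = refl

ι-mono-≤ : ∀ {m n} → m ≤ℕ n → ι m ≤ ι n
ι-mono-≤ {m} {n} m≤n rewrite ι≡mkℚ m | ι≡mkℚ n =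
  *≤* (subst₂ ℤ._≤_ (sym (ℤ.*-identityʳ (ℤ.+ m))) (sym (ℤ.*-identityʳ (ℤ.+ n))) (+≤+ m≤n))

ι-cancel-≤ : ∀ {m n} → ι m ≤ ι n → m ≤ℕ n
ι-cancel-≤ {m} {n} ιm≤ιn rewrite ι≡mkℚ m | ι≡mkℚ n with ιm≤ιn
... | *≤* le = ℤ.drop‿+≤+ (subst₂ ℤ._≤_ (ℤ.*-identityʳ (ℤ.+ m)) (ℤ.*-identityʳ (ℤ.+ n)) le)

ι-injective : ∀ {m n} → ι m ≡ ι n → m ≡ n
ι-injective e = ℕ.≤-antisym (ι-cancel-≤ (≤-reflexive e)) (ι-cancel-≤ (≤-reflexive (sym e)))

*-cancelˡ-≡-pos : ∀ r .{{_ : Positive r}} {p q} → r * p ≡ r * q → p ≡ q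
*-cancelˡ-≡-pos r e =
  ≤-antisym (*-cancelˡ-≤-pos r (≤-reflexive e)) (*-cancelˡ-≤-pos r (≤-reflexive (sym e)))

sumℚ-↭ : ∀ {xs ys : List ℚ} → xs ↭ ys → sumℚ xs ≡ sumℚ ys
sumℚ-↭ = foldr-commMonoid +-0-isCommutativeMonoid ∘ ↭⇒↭ₛ

module _ {A : Set} where

  sumℚ-map-mono : ∀ (xs : List A) {f g : A → ℚ} → (∀ {x} → x ∈ₗ xs → f x ≤ g x) →
                  sumℚ (map f xs) ≤ sumℚ (map g xs)
  sumℚ-map-mono []       f≤g = ≤-refl
  sumℚ-map-mono (x ∷ xs) f≤g = +-mono-≤ (f≤g (here refl)) (sumℚ-map-mono xs (f≤g ∘ there))

  sumℚ-map-tight : ∀ (xs : List A) {f g : A → ℚ} → (∀ {x} → x ∈ₗ xs → f x ≤ g x) →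
                   sumℚ (map g xs) ≤ sumℚ (map f xs) → ∀ {x} → x ∈ₗ xs → f x ≡ g x
  sumℚ-map-tight (x ∷ xs) f≤g Σg≤Σf (here refl) =
    ≤-antisym (f≤g (here refl)) (≮⇒≥ λ fx<gx →
      <-irrefl refl (<-≤-trans (+-mono-<-≤ fx<gx (sumℚ-map-mono xs (f≤g ∘ there))) Σg≤Σf))
  sumℚ-map-tight (x ∷ xs) f≤g Σg≤Σf (there x∈xs) =
    sumℚ-map-tight xs (f≤g ∘ there) (≮⇒≥ λ Σf<Σg →
      <-irrefl refl (<-≤-trans (+-mono-≤-< (f≤g (here refl)) Σf<Σg) Σg≤Σf)) x∈xs

  sumℚ-map-filter : ∀ {P : A → Set} (P? : Decidable P) (xs : List A) (f : A → ℚ) →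
                    (∀ {x} → x ∈ₗ xs → ¬ P x → f x ≡ 0ℚ) →
                    sumℚ (map f xs) ≡ sumℚ (map f (filter P? xs))
  sumℚ-map-filter P? []       f vanish = refl
  sumℚ-map-filter P? (x ∷ xs) f vanish with P? x
  ... | yes _  = cong (f x +_) (sumℚ-map-filter P? xs f (vanish ∘ there))
  ... | no ¬Px = trans (cong (_+ sumℚ (map f xs)) (vanish (here refl) ¬Px))
                   (trans (+-identityˡ _) (sumℚ-map-filter P? xs f (vanish ∘ there)))

  module _ (_≟_ : DecidableEquality A) where
    open DecMembership _≟_ using () renaming (_∈?_ to _∈ₗ?_)

    sumℚ-map-restrict : ∀ {xs ys : List A} (f : A → ℚ) → Unique xs → Unique ys →
                        (∀ {x} → x ∈ₗ ys → x ∈ₗ xs) →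
                        (∀ {x} → x ∈ₗ xs → x ∉ₗ ys → f x ≡ 0ℚ) →
                        sumℚ (map f xs) ≡ sumℚ (map f ys)
    sumℚ-map-restrict {xs} {ys} f uxs uys ys⊆xs vanish =
      trans (sumℚ-map-filter (_∈ₗ? ys) xs f vanish) (sumℚ-↭ (map⁺ f filtered↭ys))
      where
      filtered↭ys : filter (_∈ₗ? ys) xs ↭ ys
      filtered↭ys = ∼bag⇒↭ (unique∧set⇒bag (filter⁺ (_∈ₗ? ys) uxs) uys (mk⇔
        (proj₂ ∘ ∈-filter⁻ (_∈ₗ? ys) {xs = xs})
        (λ x∈ys → ∈-filter⁺ (_∈ₗ? ys) (ys⊆xs x∈ys) x∈ys)))

sumOver : ∀ {n} → Subset n → (Fin n → ℚ) → ℚ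
sumOver []      f = 0ℚ
sumOver (b ∷ S) f = (if b then f zero else 0ℚ) + sumOver S (f ∘ suc)

sumOver-mono : ∀ {n} (S : Subset n) {f g : Fin n → ℚ} →
               (∀ a → f a ≤ g a) → sumOver S f ≤ sumOver S g
sumOver-mono []          f≤g = ≤-refl
sumOver-mono (true ∷ S)  f≤g = +-mono-≤ (f≤g zero) (sumOver-mono S (f≤g ∘ suc))
sumOver-mono (false ∷ S) f≤g = +-mono-≤ (≤-refl {0ℚ}) (sumOver-mono S (f≤g ∘ suc))

sumOver-0 : ∀ {n} (S : Subset n) → sumOver S (λ _ → 0ℚ) ≡ 0ℚ
sumOver-0 []          = refl
sumOver-0 (true ∷ S)  = cong (0ℚ +_) (sumOver-0 S)
sumOver-0 (false ∷ S) = cong (0ℚ +_) (sumOver-0 S)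

sumOver-+ : ∀ {n} (S : Subset n) (f g : Fin n → ℚ) →
            sumOver S (λ a → f a + g a) ≡ sumOver S f + sumOver S g
sumOver-+ []          f g = refl
sumOver-+ (true ∷ S)  f g = trans (cong (f zero + g zero +_) (sumOver-+ S (f ∘ suc) (g ∘ suc)))
  (interchange (f zero) (g zero) (sumOver S (f ∘ suc)) (sumOver S (g ∘ suc)))
sumOver-+ (false ∷ S) f g = trans (cong (0ℚ +_) (sumOver-+ S (f ∘ suc) (g ∘ suc)))
  (interchange 0ℚ 0ℚ (sumOver S (f ∘ suc)) (sumOver S (g ∘ suc)))

sumOver-1 : ∀ {n} (S : Subset n) → sumOver S (λ _ → 1ℚ) ≡ ι ∣ S ∣
sumOver-1 []          = refl
sumOver-1 (true ∷ S)  = trans (cong (1ℚ +_) (sumOver-1 S)) (sym (ι-suc ∣ S ∣))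
sumOver-1 (false ∷ S) = trans (+-identityˡ _) (sumOver-1 S)

sumOver-indicator : ∀ {n} (H S : Subset n) (c : ℚ) →
                    sumOver S (λ a → if lookup H a then c else 0ℚ) ≡ c * ι ∣ H ∩ S ∣
sumOver-indicator []      []      c = sym (*-zeroʳ c)
sumOver-indicator (h ∷ H) (s ∷ S) c =
  trans (cong ((if s then (if h then c else 0ℚ) else 0ℚ) +_) (sumOver-indicator H S c)) (head h s)
  where
  open ≡.≡-Reasoning
  head : ∀ h s → (if s then (if h then c else 0ℚ) else 0ℚ) + c * ι ∣ H ∩ S ∣ ≡
                 c * ι ∣ (h ∷ H) ∩ (s ∷ S) ∣
  head true true = begin
    c + c * ι ∣ H ∩ S ∣       ≡⟨ cong (_+ c * ι ∣ H ∩ S ∣) (*-identityʳ c) ⟨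
    c * 1ℚ + c * ι ∣ H ∩ S ∣  ≡⟨ *-distribˡ-+ c 1ℚ (ι ∣ H ∩ S ∣) ⟨
    c * (1ℚ + ι ∣ H ∩ S ∣)    ≡⟨ cong (c *_) (ι-suc ∣ H ∩ S ∣) ⟨
    c * ι (suc ∣ H ∩ S ∣)     ∎
  head true  false = +-identityˡ _
  head false true  = +-identityˡ _
  head false false = +-identityˡ _

x∈p⇒1≤∣p∣ : ∀ {n} {x : Fin n} {p : Subset n} → x ∈ p → 1 ≤ℕ ∣ p ∣
x∈p⇒1≤∣p∣ {x = x} {p} x∈p = subst (_≤ℕ ∣ p ∣) (∣⁅x⁆∣≡1 x)
  (p⊆q⇒∣p∣≤∣q∣ (λ {y} y∈⁅x⁆ → subst (_∈ p) (sym (x∈⁅y⁆⇒x≡y x y∈⁅x⁆)) x∈p))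

p⊆q∧∣q∣≤∣p∣⇒p≡q : ∀ {n} {p q : Subset n} → p ⊆ q → ∣ q ∣ ≤ℕ ∣ p ∣ → p ≡ q
p⊆q∧∣q∣≤∣p∣⇒p≡q {p = p} p⊆q ∣q∣≤∣p∣ = ⊆-antisym p⊆q λ {x} x∈q →
  decidable-stable (x ∈? p) λ x∉p → ℕ.<⇒≱ (p⊂q⇒∣p∣<∣q∣ (p⊆q , x , x∈q , x∉p)) ∣q∣≤∣p∣

module _ {n : ℕ} (C : Family n) (y : Subset n → ℚ) where

  weightedHits : Subset n → ℚ
  weightedHits S = sumℚ (map (λ H → y H * ι ∣ H ∩ S ∣) C)

  sumOver-load : ∀ S → sumOver S (load C y) ≡ weightedHits S
  sumOver-load S = go C
    where
    go : ∀ D → sumOver S (load D y) ≡ sumℚ (map (λ H → y H * ι ∣ H ∩ S ∣) D)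
    go []      = sumOver-0 S
    go (H ∷ D) = trans (sumOver-+ S (λ a → if lookup H a then y H else 0ℚ) (load D y))
                       (cong₂ _+_ (sumOver-indicator H S (y H)) (go D))

  module _ (packing : FractionalPacking C y) {S : Subset n} (cover : Cover C S) where

    weight≤hitWeight : ∀ {H} → H ∈ₗ C → y H ≤ y H * ι ∣ H ∩ S ∣
    weight≤hitWeight {H} H∈C with cover H∈C
    ... | a , a∈H , a∈S = subst (_≤ y H * ι ∣ H ∩ S ∣) (*-identityʳ (y H))
      (*-monoˡ-≤-nonNeg (y H) {{nonNegative (proj₁ packing H∈C)}}
        (ι-mono-≤ (x∈p⇒1≤∣p∣ (x∈p∩q⁺ (a∈H , a∈S)))))

    weightedHits≤size : weightedHits S ≤ ι ∣ S ∣
    weightedHits≤size = begin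
      weightedHits S       ≡⟨ sumOver-load S ⟨
      sumOver S (load C y) ≤⟨ sumOver-mono S (proj₂ packing) ⟩
      sumOver S (λ _ → 1ℚ) ≡⟨ sumOver-1 S ⟩
      ι ∣ S ∣              ∎
      where open ≤-Reasoning

    value≤size : value C y ≤ ι ∣ S ∣
    value≤size = ≤-trans (sumℚ-map-mono C weight≤hitWeight) weightedHits≤size

    complementary-slackness : value C y ≡ ι ∣ S ∣ → ∀ {H} → H ∈ₗ C → 0ℚ < y H → ∣ H ∩ S ∣ ≡ 1
    complementary-slackness value≡size {H} H∈C 0<yH =
      ι-injective (*-cancelˡ-≡-pos (y H) {{positive 0<yH}} (begin
        y H * ι ∣ H ∩ S ∣ ≡⟨ sumℚ-map-tight C weight≤hitWeight weightedHits≤value H∈C ⟨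
        y H               ≡⟨ *-identityʳ (y H) ⟨
        y H * 1ℚ          ∎))
      where
      open ≡.≡-Reasoning
      weightedHits≤value : weightedHits S ≤ value C y
      weightedHits≤value = subst (weightedHits S ≤_) (sym value≡size) weightedHits≤size

module _ {n : ℕ} {D : Family n} where

  MinTransversal-size : ∀ {B B′} → MinTransversal D B → MinTransversal D B′ → ∣ B ∣ ≡ ∣ B′ ∣
  MinTransversal-size minB minB′ =
    ℕ.≤-antisym (proj₂ minB _ (proj₁ minB′)) (proj₂ minB′ _ (proj₁ minB))

  coverLowerBound⇒MinTransversal : ∀ {k B} → (∀ B′ → Cover D B′ → k ≤ℕ ∣ B′ ∣) →
                                   Cover D B → ∣ B ∣ ≡ k → MinTransversal D B
  coverLowerBound⇒MinTransversal {k} {B} lower cover ∣B∣≡k =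
    (cover , λ B′ B′⊆B cover′ → p⊆q∧∣q∣≤∣p∣⇒p≡q B′⊆B (∣B∣≤ B′ cover′)) ,
    (λ B′ transversal′ → ∣B∣≤ B′ (proj₁ transversal′))
    where
    ∣B∣≤ : ∀ B′ → Cover D B′ → ∣ B ∣ ≤ℕ ∣ B′ ∣
    ∣B∣≤ B′ cover′ = subst (_≤ℕ ∣ B′ ∣) (sym ∣B∣≡k) (lower B′ cover′)

  packing⇒coverSize≥ : ∀ {y k B} → FractionalPacking D y → value D y ≡ ι k →
                       Cover D B → k ≤ℕ ∣ B ∣
  packing⇒coverSize≥ {y} {k} {B} packing value≡k cover =
    ι-cancel-≤ (subst (_≤ ι ∣ B ∣) value≡k (value≤size D y packing cover))

  value≡size⇒IntegralBlocking : ∀ {y B} → FractionalPacking D y → Cover D B →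
                                value D y ≡ ι ∣ B ∣ → IntegralBlocking D
  value≡size⇒IntegralBlocking {y} {B} packing cover value≡size =
    ∣ B ∣ ,
    (B , coverLowerBound⇒MinTransversal (λ _ → packing⇒coverSize≥ packing value≡size) cover refl
       , refl) ,
    (y , packing , value≡size) , λ y′ packing′ → value≤size D y′ packing′ cover

module _ {n : ℕ} {C D : Family n} {y : Subset n → ℚ} (uniqueC : Unique C) (uniqueD : Unique D)
         (D⊆C : ∀ {H} → H ∈ₗ D → H ∈ₗ C) (vanish : ∀ {H} → H ∈ₗ C → H ∉ₗ D → y H ≡ 0ℚ) where

  private
    restrict : (f : Subset n → ℚ) → (∀ {H} → y H ≡ 0ℚ → f H ≡ 0ℚ) →
               sumℚ (map f D) ≡ sumℚ (map f C)
    restrict f f-vanish = sym (sumℚ-map-restrict (≡-dec Bool._≟_) f uniqueC uniqueD D⊆C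
      (λ H∈C H∉D → f-vanish (vanish H∈C H∉D)))

    if-vanish : ∀ b {q} → q ≡ 0ℚ → (if b then q else 0ℚ) ≡ 0ℚ
    if-vanish true  q≡0 = q≡0
    if-vanish false q≡0 = refl

  value-restrict : value D y ≡ value C y
  value-restrict = restrict y (λ y≡0 → y≡0)

  FractionalPacking-restrict : FractionalPacking C y → FractionalPacking D y
  FractionalPacking-restrict (nonNeg , load≤1) =
    nonNeg ∘ D⊆C , λ a → subst (_≤ 1ℚ) (sym (restrict _ (if-vanish _))) (load≤1 a)

corollary3p5 : ∀ {n : ℕ} (C Ct : Family n) →
    Clutter C → MinTransversalCovered C → IntegralBlocking C →
    IsTilde C Ct →
    MinTransversalCovered Ct × IntegralBlocking Ct ×
      (∀ B → MinTransversal C B → MinTransversal Ct B)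
corollary3p5 C Ct clutter covered (k , (B₀ , minB₀ , ∣B₀∣≡k) , (y , packing , value≡k) , _)
             (uniqueCt , tilde⊆ , ⊆tilde) =
  (λ a → let B , minB , a∈B = covered a in B , minb⊆ minB , a∈B) ,
  value≡size⇒IntegralBlocking packingCt (coverCt (proj₁ (proj₁ minB₀)))
    (trans valueCt≡k (cong ι (sym ∣B₀∣≡k))) ,
  λ _ → minb⊆
  where
  Ct⊆C : ∀ {H} → H ∈ₗ Ct → H ∈ₗ C
  Ct⊆C H∈Ct = proj₁ (tilde⊆ _ H∈Ct)

  coverCt : ∀ {B} → Cover C B → Cover Ct B
  coverCt cover = cover ∘ Ct⊆C

  value≡size : ∀ {B} → MinTransversal C B → value C y ≡ ι ∣ B ∣
  value≡size minB = trans value≡k (cong ι (trans (sym ∣B₀∣≡k) (MinTransversal-size minB₀ minB)))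

  support⊆Ct : ∀ {H} → H ∈ₗ C → 0ℚ < y H → H ∈ₗ Ct
  support⊆Ct H∈C 0<yH = ⊆tilde _ H∈C λ B minB →
    complementary-slackness C y packing (proj₁ (proj₁ minB)) (value≡size minB) H∈C 0<yH

  vanish : ∀ {H} → H ∈ₗ C → H ∉ₗ Ct → y H ≡ 0ℚ
  vanish H∈C H∉Ct = ≤-antisym (≮⇒≥ (H∉Ct ∘ support⊆Ct H∈C)) (proj₁ packing H∈C)

  packingCt : FractionalPacking Ct y
  packingCt = FractionalPacking-restrict (Clutter.distinct clutter) uniqueCt Ct⊆C vanish packing

  valueCt≡k : value Ct y ≡ ι k
  valueCt≡k = trans (value-restrict (Clutter.distinct clutter) uniqueCt Ct⊆C vanish) value≡k

  minb⊆ : ∀ {B} → MinTransversal C B → MinTransversal Ct B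
  minb⊆ minB = coverLowerBound⇒MinTransversal (λ _ → packing⇒coverSize≥ packingCt valueCt≡k)
    (coverCt (proj₁ (proj₁ minB))) (trans (MinTransversal-size minB minB₀) ∣B₀∣≡k)
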